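{- Let $T$ be a rooted tree with heavy-path decomposition as described in the context, let $\mu=(v_1,\dots,v_m)$ be a path of the decomposition with anchor $a_\mu$, and let $P=(a_\mu=v_0,v_1,\dots,v_m)$. Algorithm DrawPath constructs a $2$-drawing $\Gamma$ of $P$ such that $\ell(a_\mu,v_1)\ge n_1$, $\ell(v_i,v_{i+1})\ge n_i+n_{i+1}$ for each $i=1,\dots,m-1$, and $\ell(P)\le 6n_\mu$.
   Context: Heavy-path decomposition: add to $T$ a dummy vertex adjacent only to the root of $T$. Starting from the root of $T$, build a path by repeatedly moving to the child of the current vertex whose subtree has the largest number of vertices, until a leaf is reached; remove this path's vertices, and recursively apply the same construction to each remaining component, rooted at its vertex closest to the root of $T$. For a resulting path $\mu=(v_1,\dots,v_m)$ ($v_1$ its top vertex), its anchor $a_\mu$ is the parent of $v_1$ in $T$ (the dummy vertex if $v_1$ is the root of $T$). Let $n_\mu$ be the total number of vertices in the subtrees rooted at children of $a_\mu$ that do not belong to the path containing $a_\mu$ ($n_\mu=n$, the number of vertices of $T$, if $a_\mu$ is the dummy vertex); and for $1\le i\le m$ let $n_i$ be the total number of vertices in the subtrees rooted at the children of $v_i$ other than $v_{i+1}$. Algorithm DrawPath: initialize $\ell(v_0,v_1)=n_1$ and $\ell(v_i,v_{i+1})=n_i+n_{i+1}$ for $i=1,\dots,m-1$; then repeatedly pick an unvisited edge of $P$ of maximum current length and visit it: when visiting $(v_i,v_{i+1})$, replace the length of each existing adjacent edge $(v_{i-1},v_i)$, $(v_{i+1},v_{i+2})$ by the maximum of its current length and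 $\ell(v_i,v_{i+1})/2$; after all edges are visited, place $v_0,\dots,v_m$ in this order on a straight-line segment with these consecutive distances. $\ell(u,w)$ is the length of edge $(u,w)$ and $\ell(P)$ the sum of the edge lengths of $P$. A $2$-drawing of a path $(w_1,\dots,w_k)$ is a straight-line drawing with all vertices on a common segment in path order and $\frac{\ell(w_{i-1},w_i)}{2}\le\ell(w_i,w_{i+1})\le 2\ell(w_{i-1},w_i)$ for $i=2,\dots,k-1$. -}

module Defs where

open import Data.Nat as ℕ using (ℕ; zero; suc)
open import Data.Integer using (+_)
open import Data.Fin using (Fin; zero; suc; toℕ; inject₁)
open import Data.List using (List; []; _∷_; length; lookup; removeAt; map)
open import Data.Nat.ListAction using (sum)
open import Data.Bool using (Bool; true; false; if_then_else_; _∨_)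
open import Data.Product using (_×_; _,_; ∃)
open import Data.Rational using (ℚ; _/_; _≤_; _+_; _*_; _⊔_; ½; 0ℚ)
open import Relation.Nullary using (does; ¬_)
open import Relation.Binary.PropositionalEquality using (_≡_)
open import Relation.Binary.Construct.Closure.ReflexiveTransitive using (Star)

data Tree : Set where
  node : List Tree → Tree

children : Tree → List Tree
children (node cs) = cs

mutual
  size : Tree → ℕ
  size (node cs) = suc (sizes cs)

  sizes : List Tree → ℕ
  sizes []       = 0
  sizes (c ∷ cs) = size c ℕ.+ sizes cs

-- t ⊑ T : t is (the subtree rooted at) a vertex of T
data _⊑_ (t : Tree) : Tree → Set where
  here  : t ⊑ t
  below : ∀ {cs} (i : Fin (length cs)) → t ⊑ lookup cs i → t ⊑ node cs

Heaviest : (cs : List Tree) → Fin (length cs) → Set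
Heaviest cs i = ∀ j → size (lookup cs j) ℕ.≤ size (lookup cs i)

othersSize : (cs : List Tree) → Fin (length cs) → ℕ
othersSize cs i = sum (map size (removeAt cs i))

data HeavyPath : Tree → Set where
  leaf : HeavyPath (node [])
  step : ∀ {cs} (i : Fin (length cs)) → Heaviest cs i →
         HeavyPath (lookup cs i) → HeavyPath (node cs)

-- the list [n_1, …, n_m] of a heavy path (v_1, …, v_m)
pathNs : ∀ {t} → HeavyPath t → List ℕ
pathNs leaf                     = 0 ∷ []
pathNs (step {cs} i _ p)        = othersSize cs i ∷ pathNs p

-- DecompPath T t p nμ : the heavy path p starting at t is a path μ of the
-- heavy-path decomposition of T (for some tie-breaking), and nμ is n_μ.
--  * rootPath: v_1 is the root, anchor = dummy vertex, n_μ = n = size T.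
--  * anchored: v_1 = child c of the anchor a = node cs (a vertex of T),
--    whose own decomposition path continues to its heaviest child h ≠ c;
--    n_μ = total size of the subtrees of the children of a other than h.
data DecompPath (T : Tree) : (t : Tree) → HeavyPath t → ℕ → Set where
  rootPath : (p : HeavyPath T) → DecompPath T T p (size T)
  anchored : ∀ {cs} → node cs ⊑ T →
             (h : Fin (length cs)) → Heaviest cs h →
             (c : Fin (length cs)) → ¬ (c ≡ h) →
             (p : HeavyPath (lookup cs c)) →
             DecompPath T (lookup cs c) p (othersSize cs h)

-- Edge lengths of P = (v_0 = a_μ, v_1, …, v_m): edge j (0 ≤ j < m) is
-- (v_j, v_{j+1}).  A length assignment is a function Fin m → ℚ.

ℕ→ℚ : ℕ → ℚ
ℕ→ℚ n = + n / 1

initLen : (ns : List ℕ) → Fin (length ns) → ℚ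
initLen (a ∷ r) zero    = ℕ→ℚ a
initLen (a ∷ r) (suc j) = ℕ→ℚ (lookup (a ∷ r) (inject₁ j) ℕ.+ lookup r j)

adjacent : ∀ {k} → Fin k → Fin k → Bool
adjacent i j = does (toℕ j ℕ.≟ suc (toℕ i)) ∨ does (toℕ i ℕ.≟ suc (toℕ j))

State : ℕ → Set
State k = (Fin k → ℚ) × (Fin k → Bool)

relax : ∀ {k} → (Fin k → ℚ) → Fin k → (Fin k → ℚ)
relax ℓ i j = if adjacent i j then ℓ j ⊔ (½ * ℓ i) else ℓ j

mark : ∀ {k} → (Fin k → Bool) → Fin k → (Fin k → Bool)
mark vis i j = if does (toℕ j ℕ.≟ toℕ i) then true else vis j

data DPStep {k : ℕ} : State k → State k → Set where
  visit : ∀ {ℓ vis} (i : Fin k) → vis i ≡ false →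
          (∀ j → vis j ≡ false → ℓ j ≤ ℓ i) →
          DPStep (ℓ , vis) (relax ℓ i , mark vis i)

DrawPathRun : ∀ {k} → (Fin k → ℚ) → (Fin k → ℚ) → Set
DrawPathRun {k} init L =
  ∃ λ (vis : Fin k → Bool) →
    Star DPStep (init , λ _ → false) (L , vis) × (∀ j → vis j ≡ true)

-- 2-drawing of the path on a segment with consecutive distances L
TwoDrawing : ∀ {k} → (Fin k → ℚ) → Set
TwoDrawing {k} L =
  (∀ j → 0ℚ ≤ L j) ×
  (∀ (i j : Fin k) → toℕ j ≡ suc (toℕ i) → (½ * L i ≤ L j) × (L j ≤ ℕ→ℚ 2 * L i))

totalLen : ∀ {k} → (Fin k → ℚ) → ℚ
totalLen {zero}  L = 0ℚ
totalLen {suc k} L = L zero + totalLen (λ j → L (suc j))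

-- Write gᵢ for the initial length of edge i.  Every length DrawPath ever
-- assigns to edge j stays below the envelope Fⱼ = Σᵢ 2^-|i-j| gᵢ: the
-- envelope dominates g, and since ½Fᵢ ≤ Fⱼ for adjacent i and j, raising a
-- neighbour j of i to ½ℓᵢ ≤ ½Fᵢ keeps it below Fⱼ.  Visiting the unvisited
-- edges in decreasing order of length keeps the visited ones 2-smooth towards
-- their neighbours, so the final drawing is a 2-drawing.  Finally
-- ℓ(P) ≤ ΣF ≤ 3Σg ≤ 6Σnᵢ ≤ 6n_μ, because Σ 2^-|d| = 3, every nᵢ enters at
-- most two initial lengths, and the nᵢ count vertices of disjoint subtrees
-- inside the subtree of v₁, which has at most n_μ vertices.
module Submission where

open import Defs
open import Data.Nat using (ℕ)
open import Data.Fin using (Fin)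
open import Data.List using (length)
open import Data.Product using (_×_)
open import Data.Rational using (ℚ; _≤_; _*_)

open import Data.Bool using (Bool; true; false)
open import Data.Bool.Properties using (T-≡; ∨-zeroʳ)
open import Data.Empty using (⊥-elim)
open import Data.Fin using (zero; suc; toℕ; inject₁)
open import Data.Fin.Properties using (toℕ-injective)
import Data.Integer as ℤ
import Data.Integer.Properties as ℤₚ
open import Data.List using (List; []; _∷_; lookup; map)
open import Data.Maybe using (nothing)
import Data.Nat as ℕ
open import Data.Nat.Coprimality using (1-coprimeTo) renaming (sym to coprime-sym)
open import Data.Nat.ListAction using (sum)
import Data.Nat.Properties as ℕₚ
open import Data.Nat.Tactic.RingSolver using (solve-∀)
open import Data.Product using (_,_; proj₁; proj₂)
open import Data.Rational using (_+_; ½; 0ℚ; mkℚ; toℚᵘ; *≤*)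
open import Data.Rational.Properties
import Data.Rational.Unnormalised as ℚᵘ
import Data.Rational.Unnormalised.Properties as ℚᵘₚ
open import Data.Sum using (_⊎_; inj₁; inj₂)
open import Data.Vec.Functional using (tail)
open import Function using (Equivalence; _∘_)
open import Level using (0ℓ)
open import Relation.Binary.Construct.Closure.ReflexiveTransitive using (Star; ε; _◅_)
open import Relation.Binary.PropositionalEquality
open import Relation.Nullary using (¬_)
open import Relation.Nullary.Decidable using (dec-true)
open import Tactic.RingSolver using (solve)
import Tactic.RingSolver.Core.AlmostCommutativeRing as ACR

open import Algebra.Properties.CommutativeSemigroup ℕₚ.+-commutativeSemigroup using (x∙yz≈y∙xz)
open import Algebra.Properties.Monoid.Sum ℕₚ.+-0-monoid using () renaming (sum to ∑)

ℚ-ring : ACR.AlmostCommutativeRing 0ℓ 0ℓ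
ℚ-ring = ACR.fromCommutativeRing +-*-commutativeRing (λ _ → nothing)

ℕ→ℚ≡mkℚ : ∀ n → ℕ→ℚ n ≡ mkℚ (ℤ.+ n) 0 (coprime-sym (1-coprimeTo n))
ℕ→ℚ≡mkℚ n = normalize-coprime (coprime-sym (1-coprimeTo n))

ℕ→ℚ-mono-≤ : ∀ {m n} → m ℕ.≤ n → ℕ→ℚ m ≤ ℕ→ℚ n
ℕ→ℚ-mono-≤ {m} {n} m≤n rewrite ℕ→ℚ≡mkℚ m | ℕ→ℚ≡mkℚ n =
  *≤* (ℤₚ.*-monoʳ-≤-nonNeg (ℤ.+ 1) (ℤ.+≤+ m≤n))

0≤ℕ→ℚ : ∀ n → 0ℚ ≤ ℕ→ℚ n
0≤ℕ→ℚ n = ℕ→ℚ-mono-≤ {n = n} ℕ.z≤n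

toℚᵘ-ℕ→ℚ : ∀ n → toℚᵘ (ℕ→ℚ n) ℚᵘ.≃ ℚᵘ.mkℚᵘ (ℤ.+ n) 0
toℚᵘ-ℕ→ℚ n = toℚᵘ-fromℚᵘ (ℚᵘ.mkℚᵘ (ℤ.+ n) 0)

ℕ→ℚ-homo-+ : ∀ m n → ℕ→ℚ (m ℕ.+ n) ≡ ℕ→ℚ m + ℕ→ℚ n
ℕ→ℚ-homo-+ m n = toℚᵘ-injective (begin
  toℚᵘ (ℕ→ℚ (m ℕ.+ n))                      ≈⟨ toℚᵘ-ℕ→ℚ (m ℕ.+ n) ⟩
  ℚᵘ.mkℚᵘ (ℤ.+ (m ℕ.+ n)) 0                   ≈⟨ ℚᵘ.*≡* (cong (ℤ._* ℤ.+ 1) numerators) ⟩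
  ℚᵘ.mkℚᵘ (ℤ.+ m) 0 ℚᵘ.+ ℚᵘ.mkℚᵘ (ℤ.+ n) 0    ≈⟨ ℚᵘₚ.+-cong (toℚᵘ-ℕ→ℚ m) (toℚᵘ-ℕ→ℚ n) ⟨
  toℚᵘ (ℕ→ℚ m) ℚᵘ.+ toℚᵘ (ℕ→ℚ n)              ≈⟨ toℚᵘ-homo-+ (ℕ→ℚ m) (ℕ→ℚ n) ⟨
  toℚᵘ (ℕ→ℚ m + ℕ→ℚ n)                        ∎)
  where
  open ℚᵘₚ.≃-Reasoning
  numerators : ℤ.+ (m ℕ.+ n) ≡ ℤ.+ m ℤ.* ℤ.+ 1 ℤ.+ ℤ.+ n ℤ.* ℤ.+ 1
  numerators = trans (ℤₚ.pos-+ m n)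
    (sym (cong₂ ℤ._+_ (ℤₚ.*-identityʳ (ℤ.+ m)) (ℤₚ.*-identityʳ (ℤ.+ n))))

ℕ→ℚ-homo-* : ∀ m n → ℕ→ℚ (m ℕ.* n) ≡ ℕ→ℚ m * ℕ→ℚ n
ℕ→ℚ-homo-* m n = toℚᵘ-injective (begin
  toℚᵘ (ℕ→ℚ (m ℕ.* n))                      ≈⟨ toℚᵘ-ℕ→ℚ (m ℕ.* n) ⟩
  ℚᵘ.mkℚᵘ (ℤ.+ (m ℕ.* n)) 0                   ≈⟨ ℚᵘ.*≡* (cong (ℤ._* ℤ.+ 1) (ℤₚ.pos-* m n)) ⟩
  ℚᵘ.mkℚᵘ (ℤ.+ m) 0 ℚᵘ.* ℚᵘ.mkℚᵘ (ℤ.+ n) 0    ≈⟨ ℚᵘₚ.*-cong (toℚᵘ-ℕ→ℚ m) (toℚᵘ-ℕ→ℚ n) ⟨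
  toℚᵘ (ℕ→ℚ m) ℚᵘ.* toℚᵘ (ℕ→ℚ n)              ≈⟨ toℚᵘ-homo-* (ℕ→ℚ m) (ℕ→ℚ n) ⟨
  toℚᵘ (ℕ→ℚ m * ℕ→ℚ n)                        ∎)
  where open ℚᵘₚ.≃-Reasoning

p≤p+q : ∀ {p q} → 0ℚ ≤ q → p ≤ p + q
p≤p+q {p} {q} 0≤q = subst (_≤ p + q) (+-identityʳ p) (+-monoʳ-≤ p 0≤q)

0≤p+q : ∀ {p q} → 0ℚ ≤ p → 0ℚ ≤ q → 0ℚ ≤ p + q
0≤p+q 0≤p 0≤q = ≤-trans 0≤p (p≤p+q 0≤q)

½*-mono-≤ : ∀ {p q} → p ≤ q → ½ * p ≤ ½ * q
½*-mono-≤ = *-monoˡ-≤-nonNeg ½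

0≤½*p : ∀ {p} → 0ℚ ≤ p → 0ℚ ≤ ½ * p
0≤½*p {p} 0≤p = subst (_≤ ½ * p) (*-zeroʳ ½) (½*-mono-≤ 0≤p)

½*p≤p : ∀ {p} → 0ℚ ≤ p → ½ * p ≤ p
½*p≤p {p} 0≤p = begin
  ½ * p            ≤⟨ p≤p+q (0≤½*p 0≤p) ⟩
  ½ * p + ½ * p    ≡⟨ solve (p ∷ []) ℚ-ring ⟩
  p                ∎
  where open ≤-Reasoning

½*p≤q⇒p≤2*q : ∀ {p q} → ½ * p ≤ q → p ≤ ℕ→ℚ 2 * q
½*p≤q⇒p≤2*q {p} {q} ½p≤q = begin
  p                  ≡⟨ solve (p ∷ []) ℚ-ring ⟩
  ℕ→ℚ 2 * (½ * p)    ≤⟨ *-monoˡ-≤-nonNeg (ℕ→ℚ 2) ½p≤q ⟩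
  ℕ→ℚ 2 * q          ∎
  where open ≤-Reasoning

NonNeg : ∀ {k} → (Fin k → ℚ) → Set
NonNeg f = ∀ j → 0ℚ ≤ f j

Smooth : ∀ {k} → (Fin k → ℚ) → Set
Smooth F = ∀ i j → adjacent i j ≡ true → ½ * F i ≤ F j

totalLen-mono-≤ : ∀ {k} {f h : Fin k → ℚ} → (∀ j → f j ≤ h j) → totalLen f ≤ totalLen h
totalLen-mono-≤ {ℕ.zero}  f≤h = ≤-refl
totalLen-mono-≤ {ℕ.suc k} f≤h = +-mono-≤ (f≤h zero) (totalLen-mono-≤ (f≤h ∘ suc))

totalLen-ℕ→ℚ : ∀ {k} (f : Fin k → ℕ) → totalLen (ℕ→ℚ ∘ f) ≡ ℕ→ℚ (∑ f)
totalLen-ℕ→ℚ {ℕ.zero}  f = refl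
totalLen-ℕ→ℚ {ℕ.suc k} f = begin
  ℕ→ℚ (f zero) + totalLen (ℕ→ℚ ∘ tail f)  ≡⟨ cong (ℕ→ℚ (f zero) +_) (totalLen-ℕ→ℚ (tail f)) ⟩
  ℕ→ℚ (f zero) + ℕ→ℚ (∑ (tail f))         ≡⟨ ℕ→ℚ-homo-+ (f zero) (∑ (tail f)) ⟨
  ℕ→ℚ (∑ f)                               ∎
  where open ≡-Reasoning

≡ᵇ-true⇒≡ : ∀ {m n} → (m ℕ.≡ᵇ n) ≡ true → m ≡ n
≡ᵇ-true⇒≡ {m} {n} e = ℕₚ.≡ᵇ⇒≡ m n (Equivalence.from T-≡ e)

module _ {k} {i j : Fin k} where

  adjacent-next : toℕ j ≡ ℕ.suc (toℕ i) → adjacent i j ≡ true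
  adjacent-next j≡1+i rewrite dec-true (toℕ j ℕ.≟ ℕ.suc (toℕ i)) j≡1+i = refl

  adjacent-prev : toℕ j ≡ ℕ.suc (toℕ i) → adjacent j i ≡ true
  adjacent-prev j≡1+i rewrite dec-true (toℕ j ℕ.≟ ℕ.suc (toℕ i)) j≡1+i = ∨-zeroʳ _

  -- `adjacent` computes through _≡ᵇ_, so that is what we case on.
  adjacent⇒next⊎prev : adjacent i j ≡ true → toℕ j ≡ ℕ.suc (toℕ i) ⊎ toℕ i ≡ ℕ.suc (toℕ j)
  adjacent⇒next⊎prev i~j with toℕ j ℕ.≡ᵇ ℕ.suc (toℕ i) in e₁ | toℕ i ℕ.≡ᵇ ℕ.suc (toℕ j) in e₂
  ... | true  | _    = inj₁ (≡ᵇ-true⇒≡ e₁)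
  ... | false | true = inj₂ (≡ᵇ-true⇒≡ e₂)
  adjacent⇒next⊎prev () | false | false

decaySum : ∀ {k} → (Fin k → ℚ) → ℚ
decaySum {ℕ.zero}  g = 0ℚ
decaySum {ℕ.suc k} g = g zero + ½ * decaySum (tail g)

-- envelopeFrom c g j = Σᵢ 2^-|i-j| gᵢ + 2^-(j+1) c
envelopeFrom : ∀ {k} → ℚ → (Fin k → ℚ) → Fin k → ℚ
envelopeFrom c g zero    = (g zero + ½ * c) + ½ * decaySum (tail g)
envelopeFrom c g (suc j) = envelopeFrom (g zero + ½ * c) (tail g) j

envelope : ∀ {k} → (Fin k → ℚ) → Fin k → ℚ
envelope = envelopeFrom 0ℚ

decaySum-nonNeg : ∀ {k} {g : Fin k → ℚ} → NonNeg g → 0ℚ ≤ decaySum g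
decaySum-nonNeg {ℕ.zero}  g≥0 = ≤-refl
decaySum-nonNeg {ℕ.suc k} g≥0 = 0≤p+q (g≥0 zero) (0≤½*p (decaySum-nonNeg (g≥0 ∘ suc)))

≤-envelopeFrom : ∀ {k c} {g : Fin k → ℚ} → 0ℚ ≤ c → NonNeg g → ∀ j → g j ≤ envelopeFrom c g j
≤-envelopeFrom {c = c} {g} c≥0 g≥0 zero = begin
  g zero                                           ≤⟨ p≤p+q (0≤½*p c≥0) ⟩
  g zero + ½ * c                                   ≤⟨ p≤p+q (0≤½*p (decaySum-nonNeg (g≥0 ∘ suc))) ⟩
  (g zero + ½ * c) + ½ * decaySum (tail g)         ∎
  where open ≤-Reasoning
≤-envelopeFrom c≥0 g≥0 (suc j) =
  ≤-envelopeFrom (0≤p+q (g≥0 zero) (0≤½*p c≥0)) (g≥0 ∘ suc) j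

¼*p≤p : ∀ {p} → 0ℚ ≤ p → ½ * (½ * p) ≤ p
¼*p≤p p≥0 = ≤-trans (½*-mono-≤ (½*p≤p p≥0)) (½*p≤p p≥0)

-- Two neighbouring envelope values x + ½y + ¼z and ½x + y + ½z.
neighbours-balanced : ∀ {x y z} → 0ℚ ≤ x → 0ℚ ≤ y + ½ * z →
  ½ * (x + ½ * (y + ½ * z)) ≤ (y + ½ * x) + ½ * z ×
  ½ * ((y + ½ * x) + ½ * z) ≤ x + ½ * (y + ½ * z)
neighbours-balanced {x} {y} {z} x≥0 w≥0 =
  (begin
    ½ * (x + ½ * (y + ½ * z))        ≡⟨ solve (x ∷ y ∷ z ∷ []) ℚ-ring ⟩
    ½ * x + ½ * (½ * (y + ½ * z))    ≤⟨ +-monoʳ-≤ (½ * x) (¼*p≤p w≥0) ⟩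
    ½ * x + (y + ½ * z)              ≡⟨ solve (x ∷ y ∷ z ∷ []) ℚ-ring ⟩
    (y + ½ * x) + ½ * z              ∎) ,
  (begin
    ½ * ((y + ½ * x) + ½ * z)        ≡⟨ solve (x ∷ y ∷ z ∷ []) ℚ-ring ⟩
    ½ * (½ * x) + ½ * (y + ½ * z)    ≤⟨ +-monoˡ-≤ (½ * (y + ½ * z)) (¼*p≤p x≥0) ⟩
    x + ½ * (y + ½ * z)              ∎)
  where open ≤-Reasoning

envelopeFrom-smooth : ∀ {k c} {g : Fin k → ℚ} → 0ℚ ≤ c → NonNeg g →
  ∀ i j → toℕ j ≡ ℕ.suc (toℕ i) →
  ½ * envelopeFrom c g i ≤ envelopeFrom c g j × ½ * envelopeFrom c g j ≤ envelopeFrom c g i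
envelopeFrom-smooth {g = g} c≥0 g≥0 zero (suc zero) _ =
  neighbours-balanced {y = g (suc zero)} {z = decaySum (tail (tail g))}
    (0≤p+q (g≥0 zero) (0≤½*p c≥0)) (decaySum-nonNeg (g≥0 ∘ suc))
envelopeFrom-smooth c≥0 g≥0 (suc i) (suc j) j≡1+i =
  envelopeFrom-smooth (0≤p+q (g≥0 zero) (0≤½*p c≥0)) (g≥0 ∘ suc) i j (ℕₚ.suc-injective j≡1+i)

envelope-smooth : ∀ {k} {g : Fin k → ℚ} → NonNeg g → Smooth (envelope g)
envelope-smooth g≥0 i j i~j with adjacent⇒next⊎prev i~j
... | inj₁ j≡1+i = proj₁ (envelopeFrom-smooth ≤-refl g≥0 i j j≡1+i)
... | inj₂ i≡1+j = proj₂ (envelopeFrom-smooth ≤-refl g≥0 j i i≡1+j)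

-- decaySum g is exactly the part of the spread of g that falls off the left
-- end; the carry c contributes at most c.
totalLen-envelopeFrom : ∀ {k c} {g : Fin k → ℚ} → 0ℚ ≤ c → NonNeg g →
  totalLen (envelopeFrom c g) + decaySum g ≤ ℕ→ℚ 3 * totalLen g + c
totalLen-envelopeFrom {ℕ.zero} {c} c≥0 g≥0 = begin
  0ℚ + 0ℚ                 ≤⟨ p≤p+q c≥0 ⟩
  (0ℚ + 0ℚ) + c           ≡⟨ solve (c ∷ []) ℚ-ring ⟩
  ℕ→ℚ 3 * 0ℚ + c          ∎
  where open ≤-Reasoning
totalLen-envelopeFrom {ℕ.suc k} {c} {g} c≥0 g≥0 = begin
  ((x + ½ * D) + T) + (g₀ + ½ * D)   ≡⟨ regroup x g₀ D T ⟩
  (x + g₀) + (T + D)                 ≤⟨ +-monoʳ-≤ (x + g₀) (totalLen-envelopeFrom x≥0 (g≥0 ∘ suc)) ⟩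
  (x + g₀) + (ℕ→ℚ 3 * S + x)         ≡⟨ collect g₀ c S ⟩
  ℕ→ℚ 3 * (g₀ + S) + c               ∎
  where
  open ≤-Reasoning
  regroup : ∀ x g₀ D T → ((x + ½ * D) + T) + (g₀ + ½ * D) ≡ (x + g₀) + (T + D)
  regroup x g₀ D T = solve (x ∷ g₀ ∷ D ∷ T ∷ []) ℚ-ring
  collect : ∀ g₀ c S → ((g₀ + ½ * c) + g₀) + (ℕ→ℚ 3 * S + (g₀ + ½ * c)) ≡ ℕ→ℚ 3 * (g₀ + S) + c
  collect g₀ c S = solve (g₀ ∷ c ∷ S ∷ []) ℚ-ring
  g₀ x D T S : ℚ
  g₀ = g zero
  x = g₀ + ½ * c
  D = decaySum (tail g)
  T = totalLen (envelopeFrom x (tail g))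
  S = totalLen (tail g)
  x≥0 : 0ℚ ≤ x
  x≥0 = 0≤p+q (g≥0 zero) (0≤½*p c≥0)

totalLen-envelope : ∀ {k} {g : Fin k → ℚ} → NonNeg g → totalLen (envelope g) ≤ ℕ→ℚ 3 * totalLen g
totalLen-envelope {g = g} g≥0 = begin
  totalLen (envelope g)                   ≤⟨ p≤p+q (decaySum-nonNeg g≥0) ⟩
  totalLen (envelope g) + decaySum g      ≤⟨ totalLen-envelopeFrom ≤-refl g≥0 ⟩
  ℕ→ℚ 3 * totalLen g + 0ℚ                 ≡⟨ +-identityʳ _ ⟩
  ℕ→ℚ 3 * totalLen g                      ∎
  where open ≤-Reasoning

module _ {k} (ℓ : Fin k → ℚ) (e : Fin k) where

  relax-≥ : ∀ j → ℓ j ≤ relax ℓ e j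
  relax-≥ j with adjacent e j
  ... | true  = p≤p⊔q (ℓ j) (½ * ℓ e)
  ... | false = ≤-refl

  relax-adjacent : ∀ j → adjacent e j ≡ true → ½ * ℓ e ≤ relax ℓ e j
  relax-adjacent j e~j with adjacent e j
  relax-adjacent j e~j  | true  = p≤q⊔p (ℓ j) (½ * ℓ e)
  relax-adjacent j ()   | false

  relax-≤ : ∀ {j M} → ℓ j ≤ M → (adjacent e j ≡ true → ½ * ℓ e ≤ M) → relax ℓ e j ≤ M
  relax-≤ {j} ℓj≤M ½ℓe≤M with adjacent e j
  ... | true  = ⊔-lub ℓj≤M (½ℓe≤M refl)
  ... | false = ℓj≤M

module _ {k} (vis : Fin k → Bool) (e j : Fin k) where

  mark-true : mark vis e j ≡ true → j ≡ e ⊎ vis j ≡ true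
  mark-true vis′j with toℕ j ℕ.≡ᵇ toℕ e in j≡ᵇe
  ... | true  = inj₁ (toℕ-injective (≡ᵇ-true⇒≡ j≡ᵇe))
  ... | false = inj₂ vis′j

  mark-false : mark vis e j ≡ false → vis j ≡ false
  mark-false vis′j with toℕ j ℕ.≡ᵇ toℕ e
  mark-false ()    | true
  mark-false vis′j | false = vis′j

module DrawPathInvariant {k} {g F : Fin k → ℚ}
  (g≥0 : NonNeg g) (g≤F : ∀ j → g j ≤ F j) (F-smooth : Smooth F) where

  record Invariant (ℓ : Fin k → ℚ) (vis : Fin k → Bool) : Set where
    field
      g≤ℓ              : ∀ j → g j ≤ ℓ j
      ℓ≤F              : ∀ j → ℓ j ≤ F j
      visited-smooth   : ∀ i j → vis i ≡ true → adjacent i j ≡ true → ½ * ℓ i ≤ ℓ j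
      visited-dominate : ∀ i u → vis i ≡ true → vis u ≡ false → ℓ u ≤ ℓ i

  open Invariant public

  invariant-init : Invariant g (λ _ → false)
  invariant-init = record
    { g≤ℓ              = λ _ → ≤-refl
    ; ℓ≤F              = g≤F
    ; visited-smooth   = λ _ _ ()
    ; visited-dominate = λ _ _ ()
    }

  invariant-step : ∀ {s s′} → DPStep s s′ →
                   Invariant (proj₁ s) (proj₂ s) → Invariant (proj₁ s′) (proj₂ s′)
  invariant-step (visit {ℓ} {vis} e e-unvisited e-longest) I = record
    { g≤ℓ              = λ j → ≤-trans (g≤ℓ I j) (relax-≥ ℓ e j)
    ; ℓ≤F              = λ j → relax-≤ ℓ e (ℓ≤F I j)
                                 (λ e~j → ≤-trans (½*-mono-≤ (ℓ≤F I e)) (F-smooth e j e~j))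
    ; visited-smooth   = smooth′
    ; visited-dominate = dominate′
    }
    where
    ½ℓe≤ℓe : ½ * ℓ e ≤ ℓ e
    ½ℓe≤ℓe = ½*p≤p (≤-trans (g≥0 e) (g≤ℓ I e))

    e≤visited : ∀ i → mark vis e i ≡ true → ℓ e ≤ ℓ i
    e≤visited i vis′i with mark-true vis e i vis′i
    ... | inj₁ refl  = ≤-refl
    ... | inj₂ vis-i = visited-dominate I i e vis-i e-unvisited

    visited-unchanged : ∀ i → mark vis e i ≡ true → relax ℓ e i ≤ ℓ i
    visited-unchanged i vis′i = relax-≤ ℓ e ≤-refl (λ _ → ≤-trans ½ℓe≤ℓe (e≤visited i vis′i))

    smooth′ : ∀ i j → mark vis e i ≡ true → adjacent i j ≡ true → ½ * relax ℓ e i ≤ relax ℓ e j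
    smooth′ i j vis′i i~j with mark-true vis e i vis′i
    ... | inj₁ refl  = ≤-trans (½*-mono-≤ (visited-unchanged e vis′i)) (relax-adjacent ℓ e j i~j)
    ... | inj₂ vis-i = ≤-trans (½*-mono-≤ (visited-unchanged i vis′i))
                         (≤-trans (visited-smooth I i j vis-i i~j) (relax-≥ ℓ e j))

    dominate′ : ∀ i u → mark vis e i ≡ true → mark vis e u ≡ false → relax ℓ e u ≤ relax ℓ e i
    dominate′ i u vis′i vis′u = begin
      relax ℓ e u  ≤⟨ relax-≤ ℓ e (e-longest u (mark-false vis e u vis′u)) (λ _ → ½ℓe≤ℓe) ⟩
      ℓ e          ≤⟨ e≤visited i vis′i ⟩
      ℓ i          ≤⟨ relax-≥ ℓ e i ⟩
      relax ℓ e i  ∎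
      where open ≤-Reasoning

  invariant-run : ∀ {s s′} → Star DPStep s s′ →
                  Invariant (proj₁ s) (proj₂ s) → Invariant (proj₁ s′) (proj₂ s′)
  invariant-run ε        I = I
  invariant-run (s ◅ ss) I = invariant-run ss (invariant-step s I)

drawPath-twoDrawing-between : ∀ {k} {g F L : Fin k → ℚ} →
  NonNeg g → (∀ j → g j ≤ F j) → Smooth F → DrawPathRun g L →
  TwoDrawing L × (∀ j → g j ≤ L j) × (∀ j → L j ≤ F j)
drawPath-twoDrawing-between {L = L} g≥0 g≤F F-smooth (vis , run , all-visited) =
  ((λ j → ≤-trans (g≥0 j) (g≤ℓ I j)) , consecutive) , g≤ℓ I , ℓ≤F I
  where
  open DrawPathInvariant g≥0 g≤F F-smooth
  I : Invariant L vis
  I = invariant-run run invariant-init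
  consecutive : ∀ i j → toℕ j ≡ ℕ.suc (toℕ i) → ½ * L i ≤ L j × L j ≤ ℕ→ℚ 2 * L i
  consecutive i j j≡1+i =
    visited-smooth I i j (all-visited i) (adjacent-next j≡1+i) ,
    ½*p≤q⇒p≤2*q (visited-smooth I j i (all-visited j) (adjacent-prev j≡1+i))

pairSums : ℕ → (r : List ℕ) → Fin (length r) → ℕ
pairSums a r j = lookup (a ∷ r) (inject₁ j) ℕ.+ lookup r j

initLenℕ : (ns : List ℕ) → Fin (length ns) → ℕ
initLenℕ (a ∷ r) zero    = a
initLenℕ (a ∷ r) (suc j) = pairSums a r j

initLen-nonNeg : ∀ ns → NonNeg (initLen ns)
initLen-nonNeg (a ∷ r) zero    = 0≤ℕ→ℚ a
initLen-nonNeg (a ∷ r) (suc j) = 0≤ℕ→ℚ (pairSums a r j)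

totalLen-initLen : ∀ ns → totalLen (initLen ns) ≡ ℕ→ℚ (∑ (initLenℕ ns))
totalLen-initLen []          = refl
totalLen-initLen ns@(_ ∷ _) = totalLen-ℕ→ℚ (initLenℕ ns)

∑-pairSums : ∀ a r → ∑ (pairSums a r) ℕ.≤ a ℕ.+ 2 ℕ.* sum r
∑-pairSums a []      = ℕ.z≤n
∑-pairSums a (b ∷ r) = begin
  (a ℕ.+ b) ℕ.+ ∑ (pairSums b r)        ≤⟨ ℕₚ.+-monoʳ-≤ (a ℕ.+ b) (∑-pairSums b r) ⟩
  (a ℕ.+ b) ℕ.+ (b ℕ.+ 2 ℕ.* sum r)     ≡⟨ regroup a b (sum r) ⟩
  a ℕ.+ 2 ℕ.* (b ℕ.+ sum r)             ∎
  where
  open ℕₚ.≤-Reasoning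
  regroup : ∀ a b s → (a ℕ.+ b) ℕ.+ (b ℕ.+ 2 ℕ.* s) ≡ a ℕ.+ 2 ℕ.* (b ℕ.+ s)
  regroup = solve-∀

∑-initLenℕ : ∀ ns → ∑ (initLenℕ ns) ℕ.≤ 2 ℕ.* sum ns
∑-initLenℕ []      = ℕ.z≤n
∑-initLenℕ (a ∷ r) = begin
  a ℕ.+ ∑ (pairSums a r)         ≤⟨ ℕₚ.+-monoʳ-≤ a (∑-pairSums a r) ⟩
  a ℕ.+ (a ℕ.+ 2 ℕ.* sum r)      ≡⟨ regroup a (sum r) ⟩
  2 ℕ.* (a ℕ.+ sum r)            ∎
  where
  open ℕₚ.≤-Reasoning
  regroup : ∀ a s → a ℕ.+ (a ℕ.+ 2 ℕ.* s) ≡ 2 ℕ.* (a ℕ.+ s)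
  regroup = solve-∀

sizes≡sum : ∀ cs → sizes cs ≡ sum (map size cs)
sizes≡sum []       = refl
sizes≡sum (c ∷ cs) = cong (size c ℕ.+_) (sizes≡sum cs)

sum-size≡size+othersSize : ∀ cs i → sum (map size cs) ≡ size (lookup cs i) ℕ.+ othersSize cs i
sum-size≡size+othersSize (c ∷ cs) zero    = refl
sum-size≡size+othersSize (c ∷ cs) (suc i) =
  trans (cong (size c ℕ.+_) (sum-size≡size+othersSize cs i))
        (x∙yz≈y∙xz (size c) (size (lookup cs i)) (othersSize cs i))

sum-pathNs≤size : ∀ {t} (p : HeavyPath t) → sum (pathNs p) ℕ.≤ size t
sum-pathNs≤size leaf              = ℕ.z≤n
sum-pathNs≤size (step {cs} i _ p) = begin
  othersSize cs i ℕ.+ sum (pathNs p)       ≤⟨ ℕₚ.+-monoʳ-≤ (othersSize cs i) (sum-pathNs≤size p) ⟩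
  othersSize cs i ℕ.+ size (lookup cs i)   ≡⟨ ℕₚ.+-comm (othersSize cs i) _ ⟩
  size (lookup cs i) ℕ.+ othersSize cs i   ≡⟨ sum-size≡size+othersSize cs i ⟨
  sum (map size cs)                        ≡⟨ sizes≡sum cs ⟨
  sizes cs                                 ≤⟨ ℕₚ.n≤1+n (sizes cs) ⟩
  size (node cs)                           ∎
  where open ℕₚ.≤-Reasoning

size≤othersSize : ∀ cs {c h} → ¬ c ≡ h → size (lookup cs c) ℕ.≤ othersSize cs h
size≤othersSize (x ∷ xs) {zero}  {zero}  c≢h = ⊥-elim (c≢h refl)
size≤othersSize (x ∷ xs) {zero}  {suc h} c≢h = ℕₚ.m≤m+n (size x) _
size≤othersSize (x ∷ xs) {suc c} {zero}  c≢h =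
  ℕₚ.≤-trans (ℕₚ.m≤m+n _ _) (ℕₚ.≤-reflexive (sym (sum-size≡size+othersSize xs c)))
size≤othersSize (x ∷ xs) {suc c} {suc h} c≢h =
  ℕₚ.≤-trans (size≤othersSize xs (c≢h ∘ cong suc)) (ℕₚ.m≤n+m _ (size x))

size≤nμ : ∀ {T t p nμ} → DecompPath T t p nμ → size t ℕ.≤ nμ
size≤nμ (rootPath _)                  = ℕₚ.≤-refl
size≤nμ (anchored {cs} _ _ _ _ c≢h _) = size≤othersSize cs c≢h

totalLen-initLen≤2nμ : ∀ {T t p nμ} → DecompPath T t p nμ →
  totalLen (initLen (pathNs p)) ≤ ℕ→ℚ (2 ℕ.* nμ)
totalLen-initLen≤2nμ {p = p} {nμ} dp = begin
  totalLen (initLen (pathNs p))            ≡⟨ totalLen-initLen (pathNs p) ⟩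
  ℕ→ℚ (∑ (initLenℕ (pathNs p)))            ≤⟨ ℕ→ℚ-mono-≤ ∑≤2nμ ⟩
  ℕ→ℚ (2 ℕ.* nμ)                           ∎
  where
  open ≤-Reasoning
  ∑≤2nμ : ∑ (initLenℕ (pathNs p)) ℕ.≤ 2 ℕ.* nμ
  ∑≤2nμ = ℕₚ.≤-trans (∑-initLenℕ (pathNs p))
            (ℕₚ.*-monoʳ-≤ 2 (ℕₚ.≤-trans (sum-pathNs≤size p) (size≤nμ dp)))

lemma6 : (T t : Tree) (p : HeavyPath t) (nμ : ℕ) → DecompPath T t p nμ →
         (L : Fin (length (pathNs p)) → ℚ) →
         DrawPathRun (initLen (pathNs p)) L →
         TwoDrawing L
         × (∀ j → initLen (pathNs p) j ≤ L j)
         × totalLen L ≤ ℕ→ℚ 6 * ℕ→ℚ nμ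
lemma6 T t p nμ dp L run =
  let g≥0 = initLen-nonNeg (pathNs p)
      twoDrawing , initLen≤L , L≤envelope =
        drawPath-twoDrawing-between g≥0 (≤-envelopeFrom ≤-refl g≥0) (envelope-smooth g≥0) run
  in twoDrawing , initLen≤L , (begin
    totalLen L                                 ≤⟨ totalLen-mono-≤ L≤envelope ⟩
    totalLen (envelope (initLen (pathNs p)))   ≤⟨ totalLen-envelope g≥0 ⟩
    ℕ→ℚ 3 * totalLen (initLen (pathNs p))      ≤⟨ *-monoˡ-≤-nonNeg (ℕ→ℚ 3) (totalLen-initLen≤2nμ dp) ⟩
    ℕ→ℚ 3 * ℕ→ℚ (2 ℕ.* nμ)                     ≡⟨ ℕ→ℚ-homo-* 3 (2 ℕ.* nμ) ⟨
    ℕ→ℚ (3 ℕ.* (2 ℕ.* nμ))                     ≡⟨ cong ℕ→ℚ (ℕₚ.*-assoc 3 2 nμ) ⟨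
    ℕ→ℚ (6 ℕ.* nμ)                             ≡⟨ ℕ→ℚ-homo-* 6 nμ ⟩
    ℕ→ℚ 6 * ℕ→ℚ nμ                             ∎)
  where open ≤-Reasoning
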